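{- Let $a_1,a_2\in\mathbb{Z}\setminus\{0\}$, $q\in\mathbb{Z}_{\ge1}$ and $b\in\mathbb{Z}$, and assume that $\gcd(a_1a_2,q)=1$ and that every prime dividing $q$ divides $b$. For $r,s\in\mathbb{Z}$ let $$S_q(r,s,\mathbf{a},b)=\sum_{\substack{1\le\alpha,\beta\le q\\ \gcd(\alpha\beta,q)=1\\ a_1\alpha+a_2\beta\equiv b \ (\mathrm{mod}\ q)}} e_q(r\alpha+s\beta).$$ Then for all $r,s\in\mathbb{Z}$, $$S_q(r,s,\mathbf{a},b)=e_q(ra_1^{ -1}b)\,c_q(a_1s-a_2r)=e_q(sa_2^{ -1}b)\,c_q(a_2r-a_1s),$$ where $a_1^{ -1},a_2^{ -1}$ denote inverses of $a_1,a_2$ modulo $q$. In particular $S_q(q,s,\mathbf{a},b)=c_q(s)$ and $S_q(r,q,\mathbf{a},b)=c_q(r)$, which are independent of $\mathbf{a}$ and $b$.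
   Context: $\mathbf{a}=(a_1,a_2)$; $e_q(x)=e^{2i\pi x/q}$; $c_q(n)=\sum_{1\le\alpha\le q,\ \gcd(\alpha,q)=1}e_q(n\alpha)$ is the Ramanujan sum. -}

module Defs where

open import Level using (Level)
open import Algebra.Bundles using (CommutativeRing)
open import Data.Nat as ℕ using (ℕ; zero; suc; NonZero)
open import Data.Nat.GCD using (gcd)
open import Data.Nat.Divisibility using (_∣?_)
open import Data.Integer as ℤ using (ℤ; +_; ∣_∣)
open import Data.Integer.DivMod using (_%ℕ_)
open import Data.Bool using (if_then_else_; _∧_)
open import Relation.Nullary using (does)

congMod? : ℤ → ℤ → ℕ → Data.Bool.Bool
congMod? x y q = does (q ∣? ∣ x ℤ.- y ∣)

coprime? : ℕ → ℕ → Data.Bool.Bool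
coprime? n q = does (gcd n q ℕ.≟ 1)

module _ {c ℓ : Level} (R : CommutativeRing c ℓ) where
  open CommutativeRing R

  pow : Carrier → ℕ → Carrier
  pow x zero    = 1#
  pow x (suc n) = x * pow x n

  sum1 : ℕ → (ℕ → Carrier) → Carrier
  sum1 zero    f = 0#
  sum1 (suc n) f = sum1 n f + f (suc n)

  -- e_q(x) = ζ^(x mod q), where ζ plays the role of e^{2πi/q}
  eq : (ζ : Carrier) (q : ℕ) .{{_ : NonZero q}} → ℤ → Carrier
  eq ζ q x = pow ζ (x %ℕ q)

  ramanujan : (ζ : Carrier) (q : ℕ) .{{_ : NonZero q}} → ℤ → Carrier
  ramanujan ζ q n =
    sum1 q (λ α → if coprime? α q then eq ζ q (n ℤ.* + α) else 0#)

  Sq : (ζ : Carrier) (q : ℕ) .{{_ : NonZero q}} (r s a₁ a₂ b : ℤ) → Carrier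
  Sq ζ q r s a₁ a₂ b =
    sum1 q (λ α → sum1 q (λ β →
      if coprime? (α ℕ.* β) q ∧ congMod? (a₁ ℤ.* + α ℤ.+ a₂ ℤ.* + β) b q
      then eq ζ q (r ℤ.* + α ℤ.+ s ℤ.* + β)
      else 0#))

{-# OPTIONS --safe #-}
module Submission where

open import Defs
open import Level using (Level)
open import Algebra.Bundles using (CommutativeRing)
open import Data.Nat as ℕ using (ℕ; NonZero)
open import Data.Nat.GCD using (gcd)
open import Data.Nat.Primality using (Prime)
open import Data.Integer as ℤ using (ℤ; +_; ∣_∣)
open import Data.Integer.Divisibility as ℤd using ()
open import Data.Nat.Divisibility as ℕd using ()
open import Data.Product using (_×_)
open import Relation.Binary.PropositionalEquality using (_≡_; _≢_)

open import Data.Bool using (true; false; T; _∧_; if_then_else_)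
open import Data.Bool.Properties using (T-∧)
open import Data.Empty using (⊥; ⊥-elim)
open import Data.List using ([]; _∷_)
open import Data.List.Relation.Unary.All using (_∷_)
open import Data.Nat using (zero; suc; _≤_; _<_; z≤n; s≤s)
import Data.Nat.Properties as ℕP
open import Data.Nat.DivMod using (m≡m%n+[m/n]*n)
open import Data.Nat.Coprimality as ℕCp using (Coprime)
open import Data.Nat.Primality using (euclidsLemma; ¬prime[1])
open import Data.Nat.Primality.Factorisation using (PrimeFactorisation; factorise)
open import Data.Nat.ListAction using (product)
import Data.Integer.Coprimality as ℤCp
import Data.Integer.Properties as ℤP
open import Data.Integer.DivMod using (a≡a%ℕn+[a/ℕn]*n; n%ℕd<d)
open import Data.Integer.Divisibility.Signed as ℤs using (divides)
open import Data.Integer.Tactic.RingSolver using (solve-∀)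
open import Data.Product using (_,_; proj₁; proj₂)
open import Data.Sum using (inj₁; inj₂)
open import Data.Unit using (tt)
open import Function using (_⇔_; mk⇔; Equivalence; _∘_)
open import Relation.Binary.Bundles using (Setoid)
open import Relation.Binary.Structures using (IsEquivalence)
open import Relation.Nullary using (¬_; Dec; does; yes; no)
import Relation.Binary.PropositionalEquality as P

open Equivalence using (to; from)

-- For gcd(α, q) = 1 the condition a₁α + a₂β ≡ b (mod q) determines β ≡ a₂⁻¹(b − a₁α),
-- and this β is automatically prime to q because every prime factor of q divides b.
-- Summing over β first therefore leaves e_q(s a₂⁻¹ b) Σ_α e_q((r − s a₂⁻¹ a₁) α) over
-- the units α, a Ramanujan sum, whose argument may be multiplied by the unit a₂.
-- Exchanging the roles of (α, r, a₁) and (β, s, a₂) gives the other formula, and for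
-- r = q or s = q the twist e_q(q ⋯) is 1.

¬common-prime⇒coprime : ∀ {m n} .{{_ : NonZero n}} →
  (∀ {p} → Prime p → p ℕd.∣ m → p ℕd.∣ n → ⊥) → Coprime m n
¬common-prime⇒coprime {n = n} no-prime {d} (d∣m , d∣n) = go (factorise d {{d≢0}})
  where
  d≢0 : NonZero d
  d≢0 = ℕ.≢-nonZero λ { P.refl → ℕ.≢-nonZero⁻¹ n (ℕd.0∣⇒≡0 d∣n) }
  go : PrimeFactorisation d → d ≡ 1
  go record { factors = [] ; isFactorisation = d≡1 } = d≡1
  go record { factors = p ∷ ps ; isFactorisation = d≡∏ ; factorsPrime = p-prime ∷ _ } =
    ⊥-elim (no-prime p-prime (ℕd.∣-trans p∣d d∣m) (ℕd.∣-trans p∣d d∣n))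
    where
    p∣d : p ℕd.∣ d
    p∣d = P.subst (p ℕd.∣_) (P.sym d≡∏) (ℕd.m∣m*n (product ps))

coprime-*ˡ : ∀ {m n d} → Coprime (m ℕ.* n) d → Coprime m d
coprime-*ˡ {n = n} c (i∣m , i∣d) = c (ℕd.∣-trans i∣m (ℕd.m∣m*n n) , i∣d)

coprime-*ʳ : ∀ {m n d} → Coprime (m ℕ.* n) d → Coprime n d
coprime-*ʳ {m} {n} {d} c = coprime-*ˡ {n} {m} {d} (P.subst (λ k → Coprime k d) (ℕP.*-comm m n) c)

coprime-* : ∀ {m n d} → Coprime m d → Coprime n d → Coprime (m ℕ.* n) d
coprime-* {n = n} cm cn (i∣mn , i∣d) =
  cn (ℕCp.coprime-factors cm (i∣mn , ℕd.∣-trans i∣d (ℕd.m∣m*n n)) , i∣d)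

T⇔⇒≡ : ∀ {x y} → T x ⇔ T y → x ≡ y
T⇔⇒≡ {false} {false} _ = P.refl
T⇔⇒≡ {false} {true}  h = ⊥-elim (from h tt)
T⇔⇒≡ {true}  {false} h = ⊥-elim (to h tt)
T⇔⇒≡ {true}  {true}  _ = P.refl

T-does-⇔ : ∀ {a} {A : Set a} (a? : Dec A) → T (does a?) ⇔ A
T-does-⇔ (yes a) = mk⇔ (λ _ → a) (λ _ → tt)
T-does-⇔ (no ¬a) = mk⇔ (λ ()) ¬a

module Congruence (q : ℕ) where
  open import Data.Integer using (_+_; _*_; _-_; -_)
  open ℤs using (_∣_)

  m-[m-n]≡n : ∀ m n → m - (m - n) ≡ n
  m-[m-n]≡n = solve-∀

  m-n+n≡m : ∀ m n → m - n + n ≡ m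
  m-n+n≡m = solve-∀

  m+[n-m]≡n : ∀ m n → m + (n - m) ≡ n
  m+[n-m]≡n = solve-∀

  m≡n+o⇒m-n≡o : ∀ {m n o} → m ≡ n + o → m - n ≡ o
  m≡n+o⇒m-n≡o {n = n} {o} P.refl = [m+n]-m≡n n o
    where
    [m+n]-m≡n : ∀ m n → m + n - m ≡ n
    [m+n]-m≡n = solve-∀

  infix 4 _≋_
  record _≋_ (x y : ℤ) : Set where
    constructor mk≋
    field q∣x-y : + q ∣ x - y
  open _≋_ public

  ≋-by : ∀ {x y z} → x - y ≡ z → + q ∣ z → x ≋ y
  ≋-by x-y≡z q∣z = mk≋ (P.subst (+ q ∣_) (P.sym x-y≡z) q∣z)

  ∣⇒≋0 : ∀ {x} → + q ∣ x → x ≋ + 0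
  ∣⇒≋0 {x} = ≋-by (ℤP.+-identityʳ x)

  ≋-reflexive : ∀ {x y} → x ≡ y → x ≋ y
  ≋-reflexive {x} P.refl = mk≋ (divides (+ 0) (ℤP.+-inverseʳ x))

  ≋-refl : ∀ {x} → x ≋ x
  ≋-refl = ≋-reflexive P.refl

  ≋-sym : ∀ {x y} → x ≋ y → y ≋ x
  ≋-sym {x} {y} x≋y = ≋-by (negate x y) (ℤs.∣m⇒∣-m (q∣x-y x≋y))
    where
    negate : ∀ x y → y - x ≡ - (x - y)
    negate = solve-∀

  ≋-trans : ∀ {x y z} → x ≋ y → y ≋ z → x ≋ z
  ≋-trans {x} {y} {z} x≋y y≋z = ≋-by (telescope x y z) (ℤs.∣m∣n⇒∣m+n (q∣x-y x≋y) (q∣x-y y≋z))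
    where
    telescope : ∀ x y z → x - z ≡ (x - y) + (y - z)
    telescope = solve-∀

  ≋-isEquivalence : IsEquivalence _≋_
  ≋-isEquivalence = record { refl = ≋-refl ; sym = ≋-sym ; trans = ≋-trans }

  ≋-setoid : Setoid _ _
  ≋-setoid = record { isEquivalence = ≋-isEquivalence }

  ≋-+ : ∀ {x x′ y y′} → x ≋ x′ → y ≋ y′ → x + y ≋ x′ + y′
  ≋-+ {x} {x′} {y} {y′} x≋x′ y≋y′ =
    ≋-by (interchange x x′ y y′) (ℤs.∣m∣n⇒∣m+n (q∣x-y x≋x′) (q∣x-y y≋y′))
    where
    interchange : ∀ x x′ y y′ → (x + y) - (x′ + y′) ≡ (x - x′) + (y - y′)
    interchange = solve-∀

  ≋-*ˡ : ∀ c {x y} → x ≋ y → c * x ≋ c * y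
  ≋-*ˡ c {x} {y} x≋y = ≋-by (distrib c x y) (ℤs.∣n⇒∣m*n c (q∣x-y x≋y))
    where
    distrib : ∀ c x y → c * x - c * y ≡ c * (x - y)
    distrib = solve-∀

  ≋-*ʳ : ∀ c {x y} → x ≋ y → x * c ≋ y * c
  ≋-*ʳ c {x} {y} x≋y = P.subst₂ _≋_ (ℤP.*-comm c x) (ℤP.*-comm c y) (≋-*ˡ c x≋y)

  +-≋-⇔ : ∀ {x y z} → x + y ≋ z ⇔ y ≋ z - x
  +-≋-⇔ {x} {y} {z} = mk⇔ (λ h → ≋-by (P.sym (shift x y z)) (q∣x-y h))
                           (λ h → ≋-by (shift x y z) (q∣x-y h))
    where
    shift : ∀ x y z → (x + y) - z ≡ y - (z - x)
    shift = solve-∀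

  unit-*-⇔ : ∀ {u v x y} → u * v ≋ + 1 → u * x ≋ y ⇔ x ≋ v * y
  unit-*-⇔ {u} {v} {x} {y} uv≋1 = mk⇔ solve unsolve
    where
    open import Relation.Binary.Reasoning.Setoid ≋-setoid
    solve : u * x ≋ y → x ≋ v * y
    solve ux≋y = begin
      x             ≡⟨ ℤP.*-identityˡ x ⟨
      + 1 * x       ≈⟨ ≋-*ʳ x uv≋1 ⟨
      u * v * x     ≡⟨ rearrange u v x ⟩
      v * (u * x)   ≈⟨ ≋-*ˡ v ux≋y ⟩
      v * y         ∎
      where
      rearrange : ∀ u v x → u * v * x ≡ v * (u * x)
      rearrange = solve-∀
    unsolve : x ≋ v * y → u * x ≋ y
    unsolve x≋vy = begin
      u * x         ≈⟨ ≋-*ˡ u x≋vy ⟩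
      u * (v * y)   ≡⟨ ℤP.*-assoc u v y ⟨
      u * v * y     ≈⟨ ≋-*ʳ y uv≋1 ⟩
      + 1 * y       ≡⟨ ℤP.*-identityˡ y ⟩
      y             ∎

  unit-comm : ∀ {u v} → u * v ≋ + 1 → v * u ≋ + 1
  unit-comm {u} {v} = P.subst (_≋ + 1) (ℤP.*-comm u v)

  coprime-≋ : ∀ {x y} → ℤCp.Coprime x (+ q) → x ≋ y → ℤCp.Coprime y (+ q)
  coprime-≋ {x} {y} cx x≋y {d} (d∣y , d∣q) = cx (ℤs.∣⇒∣ᵤ d∣x , d∣q)
    where
    d∣x : + d ∣ x
    d∣x = P.subst (+ d ∣_) (m-n+n≡m x y)
      (ℤs.∣m∣n⇒∣m+n (ℤs.∣-trans (ℤs.∣ᵤ⇒∣ d∣q) (q∣x-y x≋y)) (ℤs.∣ᵤ⇒∣ d∣y))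

  coprime-*ℤ : ∀ {x y} → ℤCp.Coprime x (+ q) → ℤCp.Coprime y (+ q) → ℤCp.Coprime (x * y) (+ q)
  coprime-*ℤ {x} {y} cx cy = P.subst (λ n → Coprime n q) (P.sym (ℤP.abs-* x y)) (coprime-* cx cy)

  coprime-*ℤ⁻¹ : ∀ {x y} → ℤCp.Coprime (x * y) (+ q) → ℤCp.Coprime x (+ q) × ℤCp.Coprime y (+ q)
  coprime-*ℤ⁻¹ {x} {y} cxy = coprime-*ˡ {∣ x ∣} {∣ y ∣} c , coprime-*ʳ {∣ x ∣} {∣ y ∣} c
    where
    c : Coprime (∣ x ∣ ℕ.* ∣ y ∣) q
    c = P.subst (λ n → Coprime n q) (ℤP.abs-* x y) cxy

  unit⇒coprime : ∀ {u v} → u * v ≋ + 1 → ℤCp.Coprime u (+ q)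
  unit⇒coprime {u} {v} uv≋1 {d} (d∣u , d∣q) = ℕd.∣1⇒≡1 (ℤs.∣⇒∣ᵤ d∣1)
    where
    d∣1 : + d ∣ + 1
    d∣1 = P.subst (+ d ∣_) (m-[m-n]≡n (u * v) (+ 1))
      (ℤs.∣m∣n⇒∣m-n (ℤs.∣m⇒∣m*n v (ℤs.∣ᵤ⇒∣ {i = u} d∣u)) (ℤs.∣-trans (ℤs.∣ᵤ⇒∣ d∣q) (q∣x-y uv≋1)))

  T-coprime?-⇔ : ∀ {n} → T (coprime? n q) ⇔ Coprime n q
  T-coprime?-⇔ {n} = mk⇔ {B = Coprime n q} (λ t → ℕCp.gcd≡1⇒coprime (to dec t))
                                         (λ c → from dec (ℕCp.coprime⇒gcd≡1 c))
    where dec = T-does-⇔ (gcd n q ℕ.≟ 1)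

  T-congMod?-⇔ : ∀ {x y} → T (congMod? x y q) ⇔ x ≋ y
  T-congMod?-⇔ {x} {y} = mk⇔ (λ t → mk≋ (ℤs.∣ᵤ⇒∣ (to dec t)))
                             (λ x≋y → from dec (ℤs.∣⇒∣ᵤ (q∣x-y x≋y)))
    where dec = T-does-⇔ (q ℕd.∣? ∣ x - y ∣)

  T-coprime?∧congMod?-⇔ : ∀ {n x y} → T (coprime? n q ∧ congMod? x y q) ⇔ (Coprime n q × x ≋ y)
  T-coprime?∧congMod?-⇔ {n} {x} {y} = mk⇔ {B = Coprime n q × x ≋ y}
    (λ t → to T-coprime?-⇔ (proj₁ (to T-∧ t)) , to T-congMod?-⇔ (proj₂ (to T-∧ t)))
    (λ (c , h) → from T-∧ (from T-coprime?-⇔ c , from T-congMod?-⇔ h))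

  module _ .{{_ : NonZero q}} where

    -- A prime dividing q and b - A x divides b, hence A x, hence A or x.
    coprime-b-* : ∀ {A x b} → (∀ p → Prime p → p ℕd.∣ q → + p ℤd.∣ b) →
      ℤCp.Coprime A (+ q) → ℤCp.Coprime x (+ q) → ℤCp.Coprime (b - A * x) (+ q)
    coprime-b-* {A} {x} {b} rad cA cx = ¬common-prime⇒coprime no-prime
      where
      no-prime : ∀ {p} → Prime p → p ℕd.∣ ∣ b - A * x ∣ → p ℕd.∣ q → ⊥
      no-prime {p} p-prime p∣b-Ax p∣q with euclidsLemma ∣ A ∣ ∣ x ∣ p-prime p∣Ax
        where
        p∣Ax : p ℕd.∣ ∣ A ∣ ℕ.* ∣ x ∣
        p∣Ax = P.subst (p ℕd.∣_) (ℤP.abs-* A x) (ℤs.∣⇒∣ᵤ (P.subst (+ p ∣_) (m-[m-n]≡n b (A * x))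
                 (ℤs.∣m∣n⇒∣m-n (ℤs.∣ᵤ⇒∣ {i = b} (rad p p-prime p∣q)) (ℤs.∣ᵤ⇒∣ {i = b - A * x} p∣b-Ax))))
      ... | inj₁ p∣A = ¬prime[1] (P.subst Prime (cA (p∣A , p∣q)) p-prime)
      ... | inj₂ p∣x = ¬prime[1] (P.subst Prime (cx (p∣x , p∣q)) p-prime)

    %ℕ-≋ : ∀ x → x ≋ + (x ℤ.%ℕ q)
    %ℕ-≋ x = ≋-by (m≡n+o⇒m-n≡o (a≡a%ℕn+[a/ℕn]*n x q)) (divides (x ℤ./ℕ q) P.refl)

    ≋-unique : ∀ {i j} → + i ≋ + j → i ≤ j → j < i ℕ.+ q → i ≡ j
    ≋-unique {i} {j} i≋j i≤j j<i+q = ℕP.≤-antisym i≤j (ℕP.m∸n≡0⇒m≤n j∸i≡0)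
      where
      q∣j∸i : q ℕd.∣ j ℕ.∸ i
      q∣j∸i = P.subst (q ℕd.∣_) (P.cong ∣_∣ (P.trans (ℤP.m-n≡m⊖n j i) (ℤP.⊖-≥ i≤j)))
                (ℤs.∣⇒∣ᵤ (q∣x-y (≋-sym i≋j)))
      j∸i≡0 : j ℕ.∸ i ≡ 0
      j∸i≡0 with j ℕ.∸ i in eq
      ... | zero  = P.refl
      ... | suc _ = ⊥-elim (ℕP.<⇒≱ (P.subst (_< q) eq (ℕP.m<n+o⇒m∸n<o j i j<i+q))
                              (ℕd.∣⇒≤ (P.subst (q ℕd.∣_) eq q∣j∸i)))

    ≋-unique-in : ∀ k {i j} → k ≤ i → i < k ℕ.+ q → k ≤ j → j < k ℕ.+ q → + i ≋ + j → i ≡ j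
    ≋-unique-in k {i} {j} k≤i i<k+q k≤j j<k+q i≋j with ℕP.≤-total i j
    ... | inj₁ i≤j = ≋-unique i≋j i≤j (ℕP.<-≤-trans j<k+q (ℕP.+-monoˡ-≤ q k≤i))
    ... | inj₂ j≤i = P.sym (≋-unique (≋-sym i≋j) j≤i (ℕP.<-≤-trans i<k+q (ℕP.+-monoˡ-≤ q k≤j)))

    %ℕ-cong : ∀ {x y} → x ≋ y → x ℤ.%ℕ q ≡ y ℤ.%ℕ q
    %ℕ-cong {x} {y} x≋y = ≋-unique-in 0 z≤n (n%ℕd<d x q) z≤n (n%ℕd<d y q)
      (≋-trans (≋-sym (%ℕ-≋ x)) (≋-trans x≋y (%ℕ-≋ y)))

    rep : ℤ → ℕ
    rep x = suc ((x - + 1) ℤ.%ℕ q)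

    rep≤q : ∀ x → rep x ≤ q
    rep≤q x = n%ℕd<d (x - + 1) q

    rep-≋ : ∀ x → + rep x ≋ x
    rep-≋ x = ≋-trans (≋-+ (≋-refl {+ 1}) (≋-sym (%ℕ-≋ (x - + 1))))
                      (≋-reflexive (m+[n-m]≡n (+ 1) x))

if-T : ∀ {a} {A : Set a} {b} {u v : A} → T b → (if b then u else v) ≡ u
if-T {b = true} _ = P.refl

if-¬T : ∀ {a} {A : Set a} {b} {u v : A} → ¬ T b → (if b then u else v) ≡ v
if-¬T {b = false} _ = P.refl
if-¬T {b = true}  h = ⊥-elim (h tt)

module _ {c ℓ : Level} (R : CommutativeRing c ℓ) where
  open CommutativeRing R hiding (zero)
  open import Relation.Binary.Reasoning.Setoid setoid
  open import Algebra.Properties.CommutativeSemigroup +-commutativeSemigroup using (interchange)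

  Σ : ℕ → (ℕ → Carrier) → Carrier
  Σ = sum1 R

  sum1-cong : ∀ n {f g} → (∀ i → f i ≈ g i) → Σ n f ≈ Σ n g
  sum1-cong zero    f≈g = refl
  sum1-cong (suc n) f≈g = +-cong (sum1-cong n f≈g) (f≈g (suc n))

  sum1-zero : ∀ n {f} → (∀ i → 1 ≤ i → i ≤ n → f i ≈ 0#) → Σ n f ≈ 0#
  sum1-zero zero    f≈0 = refl
  sum1-zero (suc n) f≈0 =
    trans (+-cong (sum1-zero n (λ i 1≤i i≤n → f≈0 i 1≤i (ℕP.m≤n⇒m≤1+n i≤n)))
                  (f≈0 (suc n) (s≤s z≤n) ℕP.≤-refl))
          (+-identityˡ 0#)

  sum1-+ : ∀ n f g → Σ n (λ i → f i + g i) ≈ Σ n f + Σ n g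
  sum1-+ zero    f g = sym (+-identityˡ 0#)
  sum1-+ (suc n) f g = trans (+-congʳ (sum1-+ n f g)) (interchange _ _ _ _)

  sum1-swap : ∀ m n (F : ℕ → ℕ → Carrier) →
    Σ m (λ i → Σ n (λ j → F i j)) ≈ Σ n (λ j → Σ m (λ i → F i j))
  sum1-swap zero    n F = sym (sum1-zero n (λ _ _ _ → refl))
  sum1-swap (suc m) n F =
    trans (+-congʳ (sum1-swap m n F)) (sym (sum1-+ n (λ j → Σ m (λ i → F i j)) (F (suc m))))

  sum1-*ˡ : ∀ n a f → Σ n (λ i → a * f i) ≈ a * Σ n f
  sum1-*ˡ zero    a f = sym (zeroʳ a)
  sum1-*ˡ (suc n) a f = trans (+-congʳ (sum1-*ˡ n a f)) (sym (distribˡ a _ _))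

  sum1-single : ∀ n j f → 1 ≤ j → j ≤ n → (∀ i → 1 ≤ i → i ≤ n → i ≢ j → f i ≈ 0#) → Σ n f ≈ f j
  sum1-single zero    .zero f () z≤n _
  sum1-single (suc n) j f 1≤j j≤1+n f≈0 with j ℕP.≟ suc n
  ... | yes P.refl =
    trans (+-congʳ (sum1-zero n (λ i 1≤i i≤n → f≈0 i 1≤i (ℕP.m≤n⇒m≤1+n i≤n) (ℕP.<⇒≢ (s≤s i≤n)))))
          (+-identityˡ _)
  ... | no j≢1+n =
    trans (+-cong (sum1-single n j f 1≤j (ℕP.≤-pred (ℕP.≤∧≢⇒< j≤1+n j≢1+n))
                     (λ i 1≤i i≤n → f≈0 i 1≤i (ℕP.m≤n⇒m≤1+n i≤n)))
                  (f≈0 (suc n) (s≤s z≤n) ℕP.≤-refl (j≢1+n ∘ P.sym)))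
          (+-identityʳ _)

  pow-+ : ∀ x m n → pow R x (m ℕ.+ n) ≈ pow R x m * pow R x n
  pow-+ x zero    n = sym (*-identityˡ _)
  pow-+ x (suc m) n = trans (*-congˡ (pow-+ x m n)) (sym (*-assoc _ _ _))

  pow-*-≈1 : ∀ {x q} → pow R x q ≈ 1# → ∀ k → pow R x (k ℕ.* q) ≈ 1#
  pow-*-≈1 _ zero = refl
  pow-*-≈1 {x} {q} x^q≈1 (suc k) =
    trans (pow-+ x q (k ℕ.* q)) (trans (*-cong x^q≈1 (pow-*-≈1 x^q≈1 k)) (*-identityˡ 1#))

  pow-% : ∀ {x q} .{{_ : NonZero q}} → pow R x q ≈ 1# → ∀ n → pow R x (n ℕ.% q) ≈ pow R x n
  pow-% {x} {q} x^q≈1 n = begin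
    pow R x (n ℕ.% q)                                  ≈⟨ *-identityʳ _ ⟨
    pow R x (n ℕ.% q) * 1#                             ≈⟨ *-congˡ (pow-*-≈1 {x} {q} x^q≈1 (n ℕ./ q)) ⟨
    pow R x (n ℕ.% q) * pow R x (n ℕ./ q ℕ.* q)        ≈⟨ pow-+ x (n ℕ.% q) (n ℕ./ q ℕ.* q) ⟨
    pow R x (n ℕ.% q ℕ.+ n ℕ./ q ℕ.* q)                ≡⟨ P.cong (pow R x) (m≡m%n+[m/n]*n n q) ⟨
    pow R x n                                          ∎

  if-*ˡ : ∀ b a u → (if b then a * u else 0#) ≈ a * (if b then u else 0#)
  if-*ˡ true  a u = refl
  if-*ˡ false a u = sym (zeroʳ a)

  if-congᵗ : ∀ b {u u′ v} → u ≈ u′ → (if b then u else v) ≈ (if b then u′ else v)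
  if-congᵗ true  u≈u′ = u≈u′
  if-congᵗ false u≈u′ = refl

  module Characters (ζ : Carrier) (q : ℕ) .{{_ : NonZero q}} (ζ^q≈1 : pow R ζ q ≈ 1#) where
    open Congruence q

    e : ℤ → Carrier
    e = eq R ζ q

    ram : ℤ → Carrier
    ram = ramanujan R ζ q

    e-cong : ∀ {x y} → x ≋ y → e x ≡ e y
    e-cong x≋y = P.cong (pow R ζ) (%ℕ-cong x≋y)

    e-pow : ∀ n → e (+ n) ≈ pow R ζ n
    e-pow = pow-% ζ^q≈1

    e-+ : ∀ x y → e (x ℤ.+ y) ≈ e x * e y
    e-+ x y = begin
      e (x ℤ.+ y)                               ≡⟨ e-cong (≋-+ (%ℕ-≋ x) (%ℕ-≋ y)) ⟩
      e (+ (x ℤ.%ℕ q ℕ.+ y ℤ.%ℕ q))             ≈⟨ e-pow (x ℤ.%ℕ q ℕ.+ y ℤ.%ℕ q) ⟩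
      pow R ζ (x ℤ.%ℕ q ℕ.+ y ℤ.%ℕ q)           ≈⟨ pow-+ ζ (x ℤ.%ℕ q) (y ℤ.%ℕ q) ⟩
      e x * e y                                 ∎

    e-≋0 : ∀ {x} → x ≋ + 0 → e x ≈ 1#
    e-≋0 x≋0 = trans (reflexive (e-cong x≋0)) (e-pow 0)

    ram-cong : ∀ {x y} → x ≋ y → ram x ≈ ram y
    ram-cong x≋y = sum1-cong q (λ α → if-congᵗ (coprime? α q) (reflexive (e-cong (≋-*ʳ (+ α) x≋y))))

    -- Exactly one β ∈ {1, …, q} is congruent to x, namely rep x.
    sum1-select : ∀ b x (g : ℤ → Carrier) → (∀ {y y′} → y ≋ y′ → g y ≈ g y′) →
      Σ q (λ β → if b ∧ congMod? (+ β) x q then g (+ β) else 0#) ≈ (if b then g x else 0#)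
    sum1-select false x g g-cong = sum1-zero q (λ _ _ _ → refl)
    sum1-select true  x g g-cong = begin
      Σ q (λ β → if congMod? (+ β) x q then g (+ β) else 0#)
        ≈⟨ sum1-single q (rep x) _ (s≤s z≤n) (rep≤q x) others ⟩
      (if congMod? (+ rep x) x q then g (+ rep x) else 0#)
        ≡⟨ if-T (from T-congMod?-⇔ (rep-≋ x)) ⟩
      g (+ rep x)
        ≈⟨ g-cong (rep-≋ x) ⟩
      g x ∎
      where
      others : ∀ i → 1 ≤ i → i ≤ q → i ≢ rep x → (if congMod? (+ i) x q then g (+ i) else 0#) ≈ 0#
      others i 1≤i i≤q i≢rep = reflexive (if-¬T λ t → i≢rep
        (≋-unique-in 1 1≤i (s≤s i≤q) (s≤s z≤n) (s≤s (rep≤q x))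
          (≋-trans (to T-congMod?-⇔ t) (≋-sym (rep-≋ x)))))

    if-coprime∧≋-cong : ∀ {m n x y x′ y′} {u} → ((Coprime m q × x ≋ y) ⇔ (Coprime n q × x′ ≋ y′)) →
      (if coprime? m q ∧ congMod? x y q then u else 0#) ≈ (if coprime? n q ∧ congMod? x′ y′ q then u else 0#)
    if-coprime∧≋-cong {u = u} h = reflexive (P.cong (λ t → if t then u else 0#) (T⇔⇒≡ (mk⇔
      (from T-coprime?∧congMod?-⇔ ∘ to h ∘ to T-coprime?∧congMod?-⇔)
      (from T-coprime?∧congMod?-⇔ ∘ from h ∘ to T-coprime?∧congMod?-⇔))))

    -- The substitution γ = u α permutes the residues coprime to q.
    ram-*-unit : ∀ {u v} m → u ℤ.* v ≋ + 1 → ram (u ℤ.* m) ≈ ram m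
    ram-*-unit {u} {v} m uv≋1 = begin
      ram (u ℤ.* m)                    ≈⟨ sum1-cong q (λ α → sym (row-α α)) ⟩
      Σ q (λ α → Σ q (λ γ → D u α γ))  ≈⟨ sum1-swap q q (D u) ⟩
      Σ q (λ γ → Σ q (λ α → D u α γ))  ≈⟨ sum1-cong q row-γ ⟩
      ram m                            ∎
      where
      D : ℤ → ℕ → ℕ → Carrier
      D w α γ = if coprime? α q ∧ congMod? (+ γ) (w ℤ.* + α) q then e (m ℤ.* + γ) else 0#
      transfer : ∀ {w w′} → w ℤ.* w′ ≋ + 1 → ∀ {α γ} →
        Coprime α q × + γ ≋ w ℤ.* + α → Coprime γ q × + α ≋ w′ ℤ.* + γ
      transfer {w} {w′} ww′≋1 {α} (cα , γ≋wα) =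
        coprime-≋ {w ℤ.* + α} (coprime-*ℤ {w} {+ α} (unit⇒coprime {w} {w′} ww′≋1) cα) (≋-sym γ≋wα) ,
        to (unit-*-⇔ {w} {w′} ww′≋1) (≋-sym γ≋wα)
      row-α : ∀ α → Σ q (λ γ → D u α γ) ≈ (if coprime? α q then e (u ℤ.* m ℤ.* + α) else 0#)
      row-α α = begin
        Σ q (λ γ → D u α γ)
          ≈⟨ sum1-select (coprime? α q) (u ℤ.* + α) (λ y → e (m ℤ.* y)) (reflexive ∘ e-cong ∘ ≋-*ˡ m) ⟩
        (if coprime? α q then e (m ℤ.* (u ℤ.* + α)) else 0#)
          ≈⟨ if-congᵗ (coprime? α q) (reflexive (e-cong (≋-reflexive (regroup m u (+ α))))) ⟩
        (if coprime? α q then e (u ℤ.* m ℤ.* + α) else 0#) ∎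
        where
        regroup : ∀ m u α → m ℤ.* (u ℤ.* α) ≡ u ℤ.* m ℤ.* α
        regroup = solve-∀
      row-γ : ∀ γ → Σ q (λ α → D u α γ) ≈ (if coprime? γ q then e (m ℤ.* + γ) else 0#)
      row-γ γ = begin
        Σ q (λ α → D u α γ)
          ≈⟨ sum1-cong q (λ α → if-coprime∧≋-cong (mk⇔ (transfer {u} {v} uv≋1 {α} {γ})
                                                         (transfer {v} {u} (unit-comm {u} {v} uv≋1) {γ} {α}))) ⟩
        Σ q (λ α → if coprime? γ q ∧ congMod? (+ α) (v ℤ.* + γ) q then e (m ℤ.* + γ) else 0#)
          ≈⟨ sum1-select (coprime? γ q) (v ℤ.* + γ) (λ _ → e (m ℤ.* + γ)) (λ _ → refl) ⟩
        (if coprime? γ q then e (m ℤ.* + γ) else 0#) ∎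

    Sq-swap : ∀ r s A B b → Sq R ζ q r s A B b ≈ Sq R ζ q s r B A b
    Sq-swap r s A B b = trans (sum1-swap q q F) (sum1-cong q (λ β → sum1-cong q (λ α → reflexive (F-swap α β))))
      where
      F : ℕ → ℕ → Carrier
      F α β = if coprime? (α ℕ.* β) q ∧ congMod? (A ℤ.* + α ℤ.+ B ℤ.* + β) b q
              then e (r ℤ.* + α ℤ.+ s ℤ.* + β) else 0#
      F-swap : ∀ α β → F α β ≡ (if coprime? (β ℕ.* α) q ∧ congMod? (B ℤ.* + β ℤ.+ A ℤ.* + α) b q
                                 then e (s ℤ.* + β ℤ.+ r ℤ.* + α) else 0#)
      F-swap α β rewrite ℕP.*-comm α β
                       | ℤP.+-comm (A ℤ.* + α) (B ℤ.* + β)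
                       | ℤP.+-comm (r ℤ.* + α) (s ℤ.* + β) = P.refl

    Sq-eval : ∀ r s A B b i → ℤCp.Coprime A (+ q) → B ℤ.* i ≋ + 1 →
      (∀ p → Prime p → p ℕd.∣ q → + p ℤd.∣ b) →
      Sq R ζ q r s A B b ≈ e (s ℤ.* i ℤ.* b) * ram (B ℤ.* r ℤ.- A ℤ.* s)
    Sq-eval r s A B b i cA Bi≋1 rad = begin
      Sq R ζ q r s A B b
        ≈⟨ sum1-cong q row ⟩
      Σ q (λ α → e (s ℤ.* i ℤ.* b) * (if coprime? α q then e (m ℤ.* + α) else 0#))
        ≈⟨ sum1-*ˡ q _ _ ⟩
      e (s ℤ.* i ℤ.* b) * ram m
        ≈⟨ *-congˡ (ram-*-unit {B} {i} m Bi≋1) ⟨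
      e (s ℤ.* i ℤ.* b) * ram (B ℤ.* m)
        ≈⟨ *-congˡ (ram-cong Bm≋Br-As) ⟩
      e (s ℤ.* i ℤ.* b) * ram (B ℤ.* r ℤ.- A ℤ.* s) ∎
      where
      m : ℤ
      m = r ℤ.- s ℤ.* i ℤ.* A
      X : ℕ → ℤ
      X α = i ℤ.* (b ℤ.- A ℤ.* + α)
      solve-β : ∀ {α β} → (Coprime (α ℕ.* β) q × A ℤ.* + α ℤ.+ B ℤ.* + β ≋ b) ⇔ (Coprime α q × + β ≋ X α)
      solve-β {α} {β} = mk⇔
        (λ (cαβ , h) → coprime-*ˡ {α} {β} {q} cαβ , to (unit-*-⇔ {B} {i} Bi≋1) (to (+-≋-⇔ {A ℤ.* + α}) h))
        (λ (cα , β≋Xα) → coprime-* {α} {β} {q} cα (cβ cα β≋Xα) ,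
                         from (+-≋-⇔ {A ℤ.* + α}) (from (unit-*-⇔ {B} {i} Bi≋1) β≋Xα))
        where
        cβ : Coprime α q → + β ≋ X α → Coprime β q
        cβ cα β≋Xα = coprime-≋ {X α} (coprime-*ℤ {i} (unit⇒coprime {i} {B} (unit-comm {B} {i} Bi≋1))
                                                  (coprime-b-* {A} {+ α} {b} rad cA cα))
                                      (≋-sym β≋Xα)
      regroup : ∀ r s i b A α → r ℤ.* α ℤ.+ s ℤ.* (i ℤ.* (b ℤ.- A ℤ.* α))
                              ≡ s ℤ.* i ℤ.* b ℤ.+ (r ℤ.- s ℤ.* i ℤ.* A) ℤ.* α
      regroup = solve-∀
      row : ∀ α → Σ q (λ β → if coprime? (α ℕ.* β) q ∧ congMod? (A ℤ.* + α ℤ.+ B ℤ.* + β) b q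
                             then e (r ℤ.* + α ℤ.+ s ℤ.* + β) else 0#)
                ≈ e (s ℤ.* i ℤ.* b) * (if coprime? α q then e (m ℤ.* + α) else 0#)
      row α = begin
        _ ≈⟨ sum1-cong q (λ β → if-coprime∧≋-cong (solve-β {α} {β})) ⟩
        Σ q (λ β → if coprime? α q ∧ congMod? (+ β) (X α) q then e (r ℤ.* + α ℤ.+ s ℤ.* + β) else 0#)
          ≈⟨ sum1-select (coprime? α q) (X α) (λ y → e (r ℤ.* + α ℤ.+ s ℤ.* y))
                    (reflexive ∘ e-cong ∘ ≋-+ (≋-refl {r ℤ.* + α}) ∘ ≋-*ˡ s) ⟩
        (if coprime? α q then e (r ℤ.* + α ℤ.+ s ℤ.* X α) else 0#)
          ≈⟨ if-congᵗ (coprime? α q) (reflexive (e-cong (≋-reflexive (regroup r s i b A (+ α))))) ⟩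
        (if coprime? α q then e (s ℤ.* i ℤ.* b ℤ.+ m ℤ.* + α) else 0#)
          ≈⟨ if-congᵗ (coprime? α q) (e-+ (s ℤ.* i ℤ.* b) (m ℤ.* + α)) ⟩
        (if coprime? α q then e (s ℤ.* i ℤ.* b) * e (m ℤ.* + α) else 0#)
          ≈⟨ if-*ˡ (coprime? α q) _ _ ⟩
        e (s ℤ.* i ℤ.* b) * (if coprime? α q then e (m ℤ.* + α) else 0#) ∎
      Bm≋Br-As : B ℤ.* m ≋ B ℤ.* r ℤ.- A ℤ.* s
      Bm≋Br-As = ≋-by (expand B r s i A) (ℤs.∣n⇒∣m*n (ℤ.- (s ℤ.* A)) (q∣x-y Bi≋1))
        where
        expand : ∀ B r s i A → B ℤ.* (r ℤ.- s ℤ.* i ℤ.* A) ℤ.- (B ℤ.* r ℤ.- A ℤ.* s)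
                             ≡ ℤ.- (s ℤ.* A) ℤ.* (B ℤ.* i ℤ.- + 1)
        expand = solve-∀

    e[q*i*b]*ram[A*s-B*q]≈ram[s] : ∀ A B b i s → A ℤ.* i ≋ + 1 →
      e (+ q ℤ.* i ℤ.* b) * ram (A ℤ.* s ℤ.- B ℤ.* + q) ≈ ram s
    e[q*i*b]*ram[A*s-B*q]≈ram[s] A B b i s Ai≋1 = begin
      e (+ q ℤ.* i ℤ.* b) * ram (A ℤ.* s ℤ.- B ℤ.* + q) ≈⟨ *-cong (e-≋0 (∣⇒≋0 q∣qib)) (ram-cong As-Bq≋As) ⟩
      1# * ram (A ℤ.* s)                                ≈⟨ *-identityˡ _ ⟩
      ram (A ℤ.* s)                                     ≈⟨ ram-*-unit {A} {i} s Ai≋1 ⟩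
      ram s                                             ∎
      where
      q∣qib : + q ℤs.∣ + q ℤ.* i ℤ.* b
      q∣qib = ℤs.∣m⇒∣m*n b (ℤs.∣m⇒∣m*n i ℤs.∣-refl)
      As-Bq≋As : A ℤ.* s ℤ.- B ℤ.* + q ≋ A ℤ.* s
      As-Bq≋As = ≋-trans (≋-+ (≋-refl {A ℤ.* s}) (∣⇒≋0 (ℤs.∣m⇒∣-m (ℤs.∣n⇒∣m*n B ℤs.∣-refl))))
                         (≋-reflexive (ℤP.+-identityʳ (A ℤ.* s)))

lemma1 : {c ℓ : Level} (R : CommutativeRing c ℓ) →
    let open CommutativeRing R in
    (ζ : Carrier) (q : ℕ) .{{_ : NonZero q}} → pow R ζ q ≈ 1# →
    (a₁ a₂ b : ℤ) → a₁ ≢ + 0 → a₂ ≢ + 0 →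
    gcd ∣ a₁ ℤ.* a₂ ∣ q ≡ 1 →
    ((p : ℕ) → Prime p → p ℕd.∣ q → + p ℤd.∣ b) →
    (a₁⁻¹ a₂⁻¹ : ℤ) →
    + q ℤd.∣ (a₁ ℤ.* a₁⁻¹ ℤ.- + 1) → + q ℤd.∣ (a₂ ℤ.* a₂⁻¹ ℤ.- + 1) →
    ((r s : ℤ) →
      (Sq R ζ q r s a₁ a₂ b
        ≈ eq R ζ q (r ℤ.* a₁⁻¹ ℤ.* b) * ramanujan R ζ q (a₁ ℤ.* s ℤ.- a₂ ℤ.* r))
      × (Sq R ζ q r s a₁ a₂ b
        ≈ eq R ζ q (s ℤ.* a₂⁻¹ ℤ.* b) * ramanujan R ζ q (a₂ ℤ.* r ℤ.- a₁ ℤ.* s)))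
    × ((s : ℤ) → Sq R ζ q (+ q) s a₁ a₂ b ≈ ramanujan R ζ q s)
    × ((r : ℤ) → Sq R ζ q r (+ q) a₁ a₂ b ≈ ramanujan R ζ q r)
lemma1 R ζ q ζ^q≈1 a₁ a₂ b _ _ gcd≡1 rad a₁⁻¹ a₂⁻¹ q∣a₁a₁⁻¹-1 q∣a₂a₂⁻¹-1 =
  (λ r s → formula₁ r s , formula₂ r s) ,
  (λ s → trans (formula₁ (+ q) s) (e[q*i*b]*ram[A*s-B*q]≈ram[s] a₁ a₂ b a₁⁻¹ s a₁a₁⁻¹≋1)) ,
  (λ r → trans (formula₂ r (+ q)) (e[q*i*b]*ram[A*s-B*q]≈ram[s] a₂ a₁ b a₂⁻¹ r a₂a₂⁻¹≋1))
  where
  open CommutativeRing R using (_≈_; _*_; trans)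
  open Congruence q
  open Characters R ζ q ζ^q≈1
  a₁a₁⁻¹≋1 : a₁ ℤ.* a₁⁻¹ ≋ + 1
  a₁a₁⁻¹≋1 = mk≋ (ℤs.∣ᵤ⇒∣ q∣a₁a₁⁻¹-1)
  a₂a₂⁻¹≋1 : a₂ ℤ.* a₂⁻¹ ≋ + 1
  a₂a₂⁻¹≋1 = mk≋ (ℤs.∣ᵤ⇒∣ q∣a₂a₂⁻¹-1)
  coprime-a₁a₂ : ℤCp.Coprime a₁ (+ q) × ℤCp.Coprime a₂ (+ q)
  coprime-a₁a₂ = coprime-*ℤ⁻¹ {a₁} {a₂} (ℕCp.gcd≡1⇒coprime gcd≡1)
  formula₁ : ∀ r s → Sq R ζ q r s a₁ a₂ b ≈ e (r ℤ.* a₁⁻¹ ℤ.* b) * ram (a₁ ℤ.* s ℤ.- a₂ ℤ.* r)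
  formula₁ r s = trans (Sq-swap r s a₁ a₂ b)
                       (Sq-eval s r a₂ a₁ b a₁⁻¹ (proj₂ coprime-a₁a₂) a₁a₁⁻¹≋1 rad)
  formula₂ : ∀ r s → Sq R ζ q r s a₁ a₂ b ≈ e (s ℤ.* a₂⁻¹ ℤ.* b) * ram (a₂ ℤ.* r ℤ.- a₁ ℤ.* s)
  formula₂ r s = Sq-eval r s a₁ a₂ b a₂⁻¹ (proj₁ coprime-a₁a₂) a₂a₂⁻¹≋1 rad
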